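{- Let $M$ be a finite set of nonzero integers and let $k$ be a positive integer with $|M|$ dividing $k$. Suppose that there is a direct KM-logarithm $f: M\to\mathbb{Z}_k$. Then there are infinitely many primes $p$ such that $M$ splits $\mathbb{Z}_p$.
   Context: $\mathbb{Z}_n$ denotes the integers modulo $n$. A subset $A$ of an abelian group $G$ is a direct factor of $G$ if there is $B\subseteq G$ with every element of $G$ uniquely of the form $a+b$, $a\in A$, $b\in B$. A direct logarithm is an injective function $f: M\to\mathbb{Z}_k$ with $f(xy)=f(x)+f(y)$ whenever $x,y,xy\in M$ and $f(M)$ a direct factor of $\mathbb{Z}_k$. A $k$-character on $\mathbb{Z}_p$ ($p$ prime) is a homomorphism $\chi:\mathbb{Z}_p^\ast\to\mathbb{Z}_k$. A direct KM-logarithm is a direct logarithm $f$ meeting the conditions of the Kummer–Mills theorem, i.e. such that there are infinitely many primes $p$ with $k$-characters $\chi$ on $\mathbb{Z}_p$ satisfying $\chi(m\bmod p)=f(m)$ for all $m\in M$. For a finite group $G$ (written additively) and a set $M$ of integers, $M$ splits $G$ if there is a subset $S\subseteq G$ such that every nonzero $g\in G$ has a unique representation $g=ms$ with $m\in M$, $s\in S$, while $0$ has no such representation (here $ms$ is the $m$-fold sum of $s$, with $ms=-((-m)s)$ for $m<0$). -}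

module Defs where

open import Data.Nat as ℕ using (ℕ; NonZero; _<_)
open import Data.Nat.DivMod using (_%_; m%n<n)
open import Data.Nat.Primality using (Prime; prime⇒nonZero)
open import Data.Integer as ℤ using (ℤ; +_; 0ℤ)
open import Data.Integer.DivMod using (_%ℕ_; n%ℕd<d)
open import Data.Fin using (Fin; toℕ; fromℕ<)
open import Data.Fin.Subset using (Subset; _∈_)
open import Data.List using (List; length)
open import Data.List.Membership.Propositional renaming (_∈_ to _∈ₗ_)
open import Data.Product using (Σ; ∃; ∃-syntax; _×_)
open import Data.Empty using (⊥)
open import Relation.Binary.PropositionalEquality using (_≡_; _≢_)
open import Relation.Nullary using (¬_)

-- ℤ_n is represented by Fin n, with arithmetic modulo n.
module _ {n : ℕ} .{{_ : NonZero n}} where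
  _+ₘ_ : Fin n → Fin n → Fin n
  a +ₘ b = fromℕ< (m%n<n (toℕ a ℕ.+ toℕ b) n)

  _*ₘ_ : Fin n → Fin n → Fin n
  a *ₘ b = fromℕ< (m%n<n (toℕ a ℕ.* toℕ b) n)

[_]_ : (n : ℕ) .{{_ : NonZero n}} → ℤ → Fin n
[ n ] x = fromℕ< (n%ℕd<d x n)

-- the m-fold sum m·s of s ∈ ℤ_n (for m < 0 this is -((-m)s)), i.e. m * s mod n
_·[_]_ : ℤ → (n : ℕ) .{{_ : NonZero n}} → Fin n → Fin n
m ·[ n ] s = [ n ] (m ℤ.* + toℕ s)

IsDirectFactor : (k : ℕ) .{{_ : NonZero k}} → (Fin k → Set) → Set
IsDirectFactor k A = Σ (Subset k) λ B →
  (∀ g → ∃[ a ] ∃[ b ] (A a × b ∈ B × a +ₘ b ≡ g)) ×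
  (∀ a b a′ b′ → A a → b ∈ B → A a′ → b′ ∈ B → a +ₘ b ≡ a′ +ₘ b′ → a ≡ a′ × b ≡ b′)

-- The finite set M ⊆ ℤ is a duplicate-free list; f : M → ℤ_k is given as a function on ℤ
-- of which only the values on M matter.
image : ∀ {k} → List ℤ → (ℤ → Fin k) → Fin k → Set
image M f a = ∃[ m ] (m ∈ₗ M × f m ≡ a)

IsDirectLogarithm : (k : ℕ) .{{_ : NonZero k}} → List ℤ → (ℤ → Fin k) → Set
IsDirectLogarithm k M f =
  (∀ x y → x ∈ₗ M → y ∈ₗ M → f x ≡ f y → x ≡ y) ×
  (∀ x y → x ∈ₗ M → y ∈ₗ M → (x ℤ.* y) ∈ₗ M → f (x ℤ.* y) ≡ f x +ₘ f y) ×
  IsDirectFactor k (image M f)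

-- k-character on ℤ_p: a homomorphism ℤ_p^* → ℤ_k; ℤ_p^* is the nonzero elements of Fin p,
-- χ is given on all of Fin p and its value at 0 is irrelevant.
IsCharacter : (p k : ℕ) .{{_ : NonZero p}} .{{_ : NonZero k}} → (Fin p → Fin k) → Set
IsCharacter p k χ = ∀ a b → toℕ a ≢ 0 → toℕ b ≢ 0 → χ (a *ₘ b) ≡ χ a +ₘ χ b

-- p admits a k-character agreeing with f on M (m mod p must lie in ℤ_p^*)
KMAt : (k : ℕ) .{{_ : NonZero k}} → List ℤ → (ℤ → Fin k) → (p : ℕ) → .{{_ : NonZero p}} → Set
KMAt k M f p = Σ (Fin p → Fin k) λ χ → IsCharacter p k χ ×
  (∀ m → m ∈ₗ M → toℕ ([ p ] m) ≢ 0 × χ ([ p ] m) ≡ f m)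

InfinitelyManyPrimes : (P : (p : ℕ) → .{{_ : NonZero p}} → Set) → Set
InfinitelyManyPrimes P = ∀ N → ∃[ p ] Σ (Prime p) λ pp → N < p × P p {{prime⇒nonZero pp}}

IsDirectKMLogarithm : (k : ℕ) .{{_ : NonZero k}} → List ℤ → (ℤ → Fin k) → Set
IsDirectKMLogarithm k M f = IsDirectLogarithm k M f × InfinitelyManyPrimes (KMAt k M f)

Splits : List ℤ → (p : ℕ) → .{{_ : NonZero p}} → Set
Splits M p = Σ (Subset p) λ S →
  (∀ g → toℕ g ≢ 0 → ∃[ m ] ∃[ s ] (m ∈ₗ M × s ∈ S × m ·[ p ] s ≡ g)) ×
  (∀ m s m′ s′ → m ∈ₗ M → s ∈ S → m′ ∈ₗ M → s′ ∈ S → m ·[ p ] s ≡ m′ ·[ p ] s′ →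
     toℕ (m ·[ p ] s) ≢ 0 → m ≡ m′ × s ≡ s′) ×
  (∀ m s → m ∈ₗ M → s ∈ S → toℕ (m ·[ p ] s) ≢ 0)

module Submission where

-- Take a prime p carrying a k-character χ that extends f, and a complement B of f(M) in ℤ_k.
-- Since χ(ms) = f(m) + χ(s) for m ∈ M and s ≠ 0, the representations g = ms with χ(s) ∈ B
-- correspond to the decompositions χ(g) = f(m) + b with b ∈ B, which exist and are unique;
-- as ℤ_p is a field, s is determined by m and g. Hence S = χ⁻¹(B) ∖ {0} splits ℤ_p.

open import Defs
open import Data.Nat as ℕ using (ℕ; NonZero; _<_)
import Data.Nat.Properties as ℕ
open import Data.Nat.DivMod using (_%_; m<n⇒m%n≡m; m*n%n≡0)
open import Data.Nat.Divisibility using (_∣_; ∣⇒≤)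
open import Data.Nat.GCD using (module Bézout)
open import Data.Nat.Coprimality using (coprime-Bézout; prime⇒coprime)
open import Data.Nat.Primality using (Prime; euclidsLemma; prime⇒nonZero)
open import Data.Integer as ℤ using (ℤ; +_; 0ℤ; 1ℤ; _+_; _*_; _-_; -_)
open import Data.Integer.Properties using (pos-*; m-n≡m⊖n; ⊖-≥; abs-*; +-identityʳ; neg-distribˡ-*)
open import Data.Integer.DivMod using (_%ℕ_; _/ℕ_; a≡a%ℕn+[a/ℕn]*n)
open import Data.Integer.Divisibility.Signed
  using (divides; ∣⇒∣ᵤ; ∣ᵤ⇒∣; ∣m∣n⇒∣m-n; ∣m⇒∣-m; ∣n⇒∣m*n; ∣m⇒∣m*n) renaming (_∣_ to _∣ᵢ_)
open import Data.Integer.Tactic.RingSolver using (solve-∀)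
open import Data.Fin using (Fin; toℕ)
open import Data.Fin.Properties using (toℕ-injective; toℕ-fromℕ<; toℕ<n)
open import Data.Fin.Subset using (Subset; _∈_)
open import Data.Fin.Subset.Properties using (_∈?_)
open import Data.Vec using (tabulate)
open import Data.Vec.Properties using (lookup⇒[]=; []=⇒lookup; lookup∘tabulate)
open import Data.List using (List; length)
open import Data.List.Membership.Propositional renaming (_∈_ to _∈ₗ_)
open import Data.List.Relation.Unary.All using (All)
open import Data.List.Relation.Unary.Unique.Propositional using (Unique)
open import Data.Bool.Properties using (T-≡)
open import Data.Product using (∃-syntax; _×_; _,_; proj₁; proj₂)
open import Data.Sum as Sum using (_⊎_)
open import Function using (_∘_; Equivalence)
open import Relation.Unary using (Pred; Decidable)
open import Relation.Nullary using (contradiction)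
open import Relation.Nullary.Decidable using (isYes; toWitness; fromWitness; ¬?; _×-dec_)
open import Relation.Binary.PropositionalEquality hiding ([_])

toℤ : ∀ {n} → Fin n → ℤ
toℤ a = + toℕ a

n∣m∧m<n⇒m≡0 : ∀ {m n} → n ∣ m → m < n → m ≡ 0
n∣m∧m<n⇒m≡0 {ℕ.zero}  _   _   = refl
n∣m∧m<n⇒m≡0 {ℕ.suc _} n∣m m<n = contradiction (∣⇒≤ n∣m) (ℕ.<⇒≱ m<n)

pos-+*≡* : ∀ a b c d e → a ℕ.+ b ℕ.* c ≡ d ℕ.* e → + a + + b * + c ≡ + d * + e
pos-+*≡* a b c d e eq = begin
  + a + + b * + c     ≡⟨ cong (_+_ (+ a)) (pos-* b c) ⟨
  + (a ℕ.+ b ℕ.* c)   ≡⟨ cong +_ eq ⟩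
  + (d ℕ.* e)         ≡⟨ pos-* d e ⟩
  + d * + e           ∎
  where open ≡-Reasoning

module _ {n : ℕ} .{{_ : NonZero n}} where

  residue-unique : ∀ {a b} → + n ∣ᵢ + a - + b → a < n → b < n → a ≡ b
  residue-unique {a} {b} n∣a-b a<n b<n =
    Sum.[ residue-unique-≥ n∣a-b a<n , (λ a≤b → sym (residue-unique-≥ n∣b-a b<n a≤b)) ]′ (ℕ.≤-total b a)
    where
    residue-unique-≥ : ∀ {x y} → + n ∣ᵢ + x - + y → x < n → y ℕ.≤ x → x ≡ y
    residue-unique-≥ {x} {y} n∣x-y x<n y≤x = ℕ.≤-antisym (ℕ.m∸n≡0⇒m≤n x∸y≡0) y≤x
      where
      n∣x∸y : n ∣ x ℕ.∸ y
      n∣x∸y = subst (λ z → n ∣ ℤ.∣ z ∣) (trans (m-n≡m⊖n x y) (⊖-≥ y≤x)) (∣⇒∣ᵤ n∣x-y)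
      x∸y≡0 : x ℕ.∸ y ≡ 0
      x∸y≡0 = n∣m∧m<n⇒m≡0 n∣x∸y (ℕ.≤-<-trans (ℕ.m∸n≤m x y) x<n)
    neg-diff : ∀ x y → - (x - y) ≡ y - x
    neg-diff = solve-∀
    n∣b-a : + n ∣ᵢ + b - + a
    n∣b-a = subst (+ n ∣ᵢ_) (neg-diff (+ a) (+ b)) (∣m⇒∣-m n∣a-b)

  ∣⇒≡ : {a b : Fin n} → + n ∣ᵢ toℤ a - toℤ b → a ≡ b
  ∣⇒≡ {a} {b} n∣a-b = toℕ-injective (residue-unique n∣a-b (toℕ<n a) (toℕ<n b))

  ∣x-[]x : ∀ x → + n ∣ᵢ x - toℤ ([ n ] x)
  ∣x-[]x x = divides (x /ℕ n) (begin
    x - toℤ ([ n ] x)                         ≡⟨ cong (λ r → x - + r) (toℕ-fromℕ< _) ⟩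
    x - + (x %ℕ n)                            ≡⟨ cong (_- + (x %ℕ n)) (a≡a%ℕn+[a/ℕn]*n x n) ⟩
    (+ (x %ℕ n) + x /ℕ n * + n) - + (x %ℕ n)  ≡⟨ cancel (+ (x %ℕ n)) (x /ℕ n) (+ n) ⟩
    x /ℕ n * + n                              ∎)
    where
    open ≡-Reasoning
    cancel : ∀ r q m → (r + q * m) - r ≡ q * m
    cancel = solve-∀

  []-≡⇒∣ : ∀ x y → [ n ] x ≡ [ n ] y → + n ∣ᵢ x - y
  []-≡⇒∣ x y eq = subst (+ n ∣ᵢ_) (regroup x y (toℤ ([ n ] x)))
    (∣m∣n⇒∣m-n (∣x-[]x x) (subst (λ r → + n ∣ᵢ y - toℤ r) (sym eq) (∣x-[]x y)))
    where
    regroup : ∀ x y r → (x - r) - (y - r) ≡ x - y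
    regroup = solve-∀

  ∣⇒[]-≡ : ∀ x y → + n ∣ᵢ x - y → [ n ] x ≡ [ n ] y
  ∣⇒[]-≡ x y n∣x-y = ∣⇒≡ (subst (+ n ∣ᵢ_) (regroup x y (toℤ ([ n ] x)) (toℤ ([ n ] y)))
      (∣m∣n⇒∣m-n n∣x-y (∣m∣n⇒∣m-n (∣x-[]x x) (∣x-[]x y))))
    where
    regroup : ∀ x y rx ry → (x - y) - ((x - rx) - (y - ry)) ≡ rx - ry
    regroup = solve-∀

  []-toℤ : (a : Fin n) → [ n ] toℤ a ≡ a
  []-toℤ a = toℕ-injective (trans (toℕ-fromℕ< _) (m<n⇒m%n≡m (toℕ<n a)))

  -- Both sides are fromℕ< of the same number up to the cast pos-*, as the bound argument of
  -- fromℕ< is irrelevant; likewise a +ₘ b is definitionally [ n ] (toℤ a + toℤ b).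
  *ₘ-as-[] : (a b : Fin n) → a *ₘ b ≡ [ n ] (toℤ a * toℤ b)
  *ₘ-as-[] a b = cong (λ z → [ n ] z) (pos-* (toℕ a) (toℕ b))

  ·-as-*ₘ : ∀ m (s : Fin n) → m ·[ n ] s ≡ ([ n ] m) *ₘ s
  ·-as-*ₘ m s = trans (∣⇒[]-≡ (m * toℤ s) (toℤ ([ n ] m) * toℤ s) n∣ms-rs) (sym (*ₘ-as-[] ([ n ] m) s))
    where
    distrib : ∀ m r s → (m - r) * s ≡ m * s - r * s
    distrib = solve-∀
    n∣ms-rs : + n ∣ᵢ m * toℤ s - toℤ ([ n ] m) * toℤ s
    n∣ms-rs = subst (+ n ∣ᵢ_) (distrib m (toℤ ([ n ] m)) (toℤ s)) (∣m⇒∣m*n (toℤ s) (∣x-[]x m))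

  +ₘ-cancelˡ : (a : Fin n) {x y : Fin n} → a +ₘ x ≡ a +ₘ y → x ≡ y
  +ₘ-cancelˡ a {x} {y} eq =
    ∣⇒≡ (subst (+ n ∣ᵢ_) (cancel (toℤ a) (toℤ x) (toℤ y)) ([]-≡⇒∣ (toℤ a + toℤ x) (toℤ a + toℤ y) eq))
    where
    cancel : ∀ a x y → (a + x) - (a + y) ≡ x - y
    cancel = solve-∀

  *ₘ-zeroʳ : (a : Fin n) {s : Fin n} → toℕ s ≡ 0 → toℕ (a *ₘ s) ≡ 0
  *ₘ-zeroʳ a {s} s≡0 = begin
    toℕ (a *ₘ s)          ≡⟨ toℕ-fromℕ< _ ⟩
    (toℕ a ℕ.* toℕ s) % n ≡⟨ cong (λ z → (toℕ a ℕ.* z) % n) s≡0 ⟩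
    (toℕ a ℕ.* 0) % n     ≡⟨ cong (_% n) (ℕ.*-zeroʳ (toℕ a)) ⟩
    0 % n                 ≡⟨ m*n%n≡0 0 n ⟩
    0                     ∎
    where open ≡-Reasoning

  ∣toℤ⇒≡0 : (a : Fin n) → + n ∣ᵢ toℤ a → toℕ a ≡ 0
  ∣toℤ⇒≡0 a n∣a = n∣m∧m<n⇒m≡0 (∣⇒∣ᵤ n∣a) (toℕ<n a)

module _ {p : ℕ} .{{_ : NonZero p}} (p-prime : Prime p) where

  prime-∣-* : ∀ i j → + p ∣ᵢ i * j → + p ∣ᵢ i ⊎ + p ∣ᵢ j
  prime-∣-* i j p∣ij = Sum.map ∣ᵤ⇒∣ ∣ᵤ⇒∣
    (euclidsLemma ℤ.∣ i ∣ ℤ.∣ j ∣ p-prime (subst (p ∣_) (abs-* i j) (∣⇒∣ᵤ p∣ij)))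

  *ₘ-cancelˡ : {a s t : Fin p} → toℕ a ≢ 0 → a *ₘ s ≡ a *ₘ t → s ≡ t
  *ₘ-cancelˡ {a} {s} {t} a≢0 eq =
    Sum.[ (λ p∣a → contradiction (∣toℤ⇒≡0 a p∣a) a≢0) , ∣⇒≡ ]′
      (prime-∣-* (toℤ a) (toℤ s - toℤ t) (subst (+ p ∣ᵢ_) (factor (toℤ a) (toℤ s) (toℤ t)) p∣as-at))
    where
    factor : ∀ a s t → a * s - a * t ≡ a * (s - t)
    factor = solve-∀
    p∣as-at : + p ∣ᵢ toℤ a * toℤ s - toℤ a * toℤ t
    p∣as-at = []-≡⇒∣ (toℤ a * toℤ s) (toℤ a * toℤ t)
      (trans (sym (*ₘ-as-[] a s)) (trans eq (*ₘ-as-[] a t)))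

  *ₘ-nonzero : {a s : Fin p} → toℕ a ≢ 0 → toℕ s ≢ 0 → toℕ (a *ₘ s) ≢ 0
  *ₘ-nonzero {a} {s} a≢0 s≢0 as≡0 =
    Sum.[ a≢0 ∘ ∣toℤ⇒≡0 a , s≢0 ∘ ∣toℤ⇒≡0 s ]′
      (prime-∣-* (toℤ a) (toℤ s) (subst (+ p ∣ᵢ_) as-0≡as p∣as-0))
    where
    p∣as-0 : + p ∣ᵢ toℤ a * toℤ s - toℤ (a *ₘ s)
    p∣as-0 = subst (λ r → + p ∣ᵢ toℤ a * toℤ s - toℤ r) (sym (*ₘ-as-[] a s)) (∣x-[]x (toℤ a * toℤ s))
    as-0≡as : toℤ a * toℤ s - toℤ (a *ₘ s) ≡ toℤ a * toℤ s
    as-0≡as = trans (cong (λ r → toℤ a * toℤ s - + r) as≡0) (+-identityʳ _)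

  unit-from-Bézout : ∀ {a} → Bézout.Identity 1 p a → ∃[ u ] + p ∣ᵢ u * + a - 1ℤ
  unit-from-Bézout {a} (Bézout.+- x y 1+ya≡xp) = - + y , divides (- + x) (begin
    - + y * + a - 1ℤ         ≡⟨ negate (+ y) (+ a) ⟩
    - (1ℤ + + y * + a)       ≡⟨ cong -_ (pos-+*≡* 1 y a x p 1+ya≡xp) ⟩
    - (+ x * + p)            ≡⟨ neg-distribˡ-* (+ x) (+ p) ⟩
    - + x * + p              ∎)
    where
    open ≡-Reasoning
    negate : ∀ y a → - y * a - 1ℤ ≡ - (1ℤ + y * a)
    negate = solve-∀
  unit-from-Bézout {a} (Bézout.-+ x y 1+xp≡ya) = + y , divides (+ x) (begin
    + y * + a - 1ℤ           ≡⟨ cong (_- 1ℤ) (pos-+*≡* 1 x p y a 1+xp≡ya) ⟨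
    (1ℤ + + x * + p) - 1ℤ    ≡⟨ cancel (+ x * + p) ⟩
    + x * + p                ∎)
    where
    open ≡-Reasoning
    cancel : ∀ z → (1ℤ + z) - 1ℤ ≡ z
    cancel = solve-∀

  unit-mod-prime : ∀ {a} → a ≢ 0 → a < p → ∃[ u ] + p ∣ᵢ u * + a - 1ℤ
  unit-mod-prime a≢0 a<p =
    unit-from-Bézout (coprime-Bézout (prime⇒coprime p-prime {{ℕ.≢-nonZero a≢0}} a<p))

  *ₘ-solvable : {a : Fin p} → toℕ a ≢ 0 → (g : Fin p) → ∃[ s ] a *ₘ s ≡ g
  *ₘ-solvable {a} a≢0 g = s , (begin
    a *ₘ s                   ≡⟨ *ₘ-as-[] a s ⟩
    [ p ] (toℤ a * toℤ s)    ≡⟨ ∣⇒[]-≡ (toℤ a * toℤ s) (toℤ g) p∣as-g ⟩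
    [ p ] toℤ g              ≡⟨ []-toℤ g ⟩
    g                        ∎)
    where
    open ≡-Reasoning
    u : ℤ
    u = proj₁ (unit-mod-prime a≢0 (toℕ<n a))
    s : Fin p
    s = [ p ] (u * toℤ g)
    regroup : ∀ a s g u → a * s - g ≡ (u * a - 1ℤ) * g - a * (u * g - s)
    regroup = solve-∀
    p∣as-g : + p ∣ᵢ toℤ a * toℤ s - toℤ g
    p∣as-g = subst (+ p ∣ᵢ_) (sym (regroup (toℤ a) (toℤ s) (toℤ g) u))
      (∣m∣n⇒∣m-n (∣m⇒∣m*n (toℤ g) (proj₂ (unit-mod-prime a≢0 (toℕ<n a))))
                 (∣n⇒∣m*n (toℤ a) (∣x-[]x (u * toℤ g))))

module _ {n ℓ} {P : Pred (Fin n) ℓ} (P? : Decidable P) where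

  decSubset : Subset n
  decSubset = tabulate (isYes ∘ P?)

  ∈-decSubset⁺ : ∀ {x} → P x → x ∈ decSubset
  ∈-decSubset⁺ {x} px = lookup⇒[]= x decSubset
    (trans (lookup∘tabulate (isYes ∘ P?) x) (Equivalence.to T-≡ (fromWitness px)))

  ∈-decSubset⁻ : ∀ {x} → x ∈ decSubset → P x
  ∈-decSubset⁻ {x} x∈ = toWitness
    (Equivalence.from T-≡ (trans (sym (lookup∘tabulate (isYes ∘ P?) x)) ([]=⇒lookup x∈)))

module _ {k p : ℕ} .{{_ : NonZero k}} .{{_ : NonZero p}} (p-prime : Prime p)
         {M : List ℤ} {f : ℤ → Fin k}
         (logarithm : IsDirectLogarithm k M f) (character : KMAt k M f p) where

  private
    χ : Fin p → Fin k
    χ = proj₁ character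

    χ-hom : IsCharacter p k χ
    χ-hom = proj₁ (proj₂ character)

    χ-extends-f : ∀ m → m ∈ₗ M → toℕ ([ p ] m) ≢ 0 × χ ([ p ] m) ≡ f m
    χ-extends-f = proj₂ (proj₂ character)

    f-injective : ∀ x y → x ∈ₗ M → y ∈ₗ M → f x ≡ f y → x ≡ y
    f-injective = proj₁ logarithm

    B : Subset k
    B = proj₁ (proj₂ (proj₂ logarithm))

    decompose : ∀ g → ∃[ a ] ∃[ b ] (image M f a × b ∈ B × a +ₘ b ≡ g)
    decompose = proj₁ (proj₂ (proj₂ (proj₂ logarithm)))

    decompose-unique : ∀ a b a′ b′ → image M f a → b ∈ B → image M f a′ → b′ ∈ B →
                       a +ₘ b ≡ a′ +ₘ b′ → a ≡ a′ × b ≡ b′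
    decompose-unique = proj₂ (proj₂ (proj₂ (proj₂ logarithm)))

  χ-· : ∀ {m s} → m ∈ₗ M → toℕ s ≢ 0 → χ (m ·[ p ] s) ≡ f m +ₘ χ s
  χ-· {m} {s} m∈M s≢0 = begin
    χ (m ·[ p ] s)          ≡⟨ cong χ (·-as-*ₘ m s) ⟩
    χ (([ p ] m) *ₘ s)      ≡⟨ χ-hom ([ p ] m) s (proj₁ (χ-extends-f m m∈M)) s≢0 ⟩
    χ ([ p ] m) +ₘ χ s      ≡⟨ cong (_+ₘ χ s) (proj₂ (χ-extends-f m m∈M)) ⟩
    f m +ₘ χ s              ∎
    where open ≡-Reasoning

  S : Subset p
  S = decSubset (λ s → ¬? (toℕ s ℕ.≟ 0) ×-dec (χ s ∈? B))

  S-covers : ∀ g → toℕ g ≢ 0 → ∃[ m ] ∃[ s ] (m ∈ₗ M × s ∈ S × m ·[ p ] s ≡ g)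
  S-covers g g≢0 = cover (decompose (χ g))
    where
    cover : ∃[ a ] ∃[ b ] (image M f a × b ∈ B × a +ₘ b ≡ χ g) →
            ∃[ m ] ∃[ s ] (m ∈ₗ M × s ∈ S × m ·[ p ] s ≡ g)
    cover (_ , b , (m , m∈M , refl) , b∈B , fm+b≡χg) =
      m , s , m∈M , ∈-decSubset⁺ _ (s≢0 , subst (_∈ B) (sym χs≡b) b∈B) , ms≡g
      where
      α≢0 : toℕ ([ p ] m) ≢ 0
      α≢0 = proj₁ (χ-extends-f m m∈M)
      s : Fin p
      s = proj₁ (*ₘ-solvable p-prime α≢0 g)
      αs≡g : ([ p ] m) *ₘ s ≡ g
      αs≡g = proj₂ (*ₘ-solvable p-prime α≢0 g)
      ms≡g : m ·[ p ] s ≡ g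
      ms≡g = trans (·-as-*ₘ m s) αs≡g
      s≢0 : toℕ s ≢ 0
      s≢0 s≡0 = g≢0 (trans (cong toℕ (sym αs≡g)) (*ₘ-zeroʳ ([ p ] m) s≡0))
      χs≡b : χ s ≡ b
      χs≡b = +ₘ-cancelˡ (f m) (trans (sym (χ-· m∈M s≢0)) (trans (cong χ ms≡g) (sym fm+b≡χg)))

  S-unique : ∀ m s m′ s′ → m ∈ₗ M → s ∈ S → m′ ∈ₗ M → s′ ∈ S → m ·[ p ] s ≡ m′ ·[ p ] s′ →
             toℕ (m ·[ p ] s) ≢ 0 → m ≡ m′ × s ≡ s′
  S-unique m s m′ s′ m∈M s∈S m′∈M s′∈S ms≡m′s′ _ = m≡m′ , s≡s′
    where
    good-s : toℕ s ≢ 0 × χ s ∈ B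
    good-s = ∈-decSubset⁻ _ s∈S
    good-s′ : toℕ s′ ≢ 0 × χ s′ ∈ B
    good-s′ = ∈-decSubset⁻ _ s′∈S
    fm+χs≡fm′+χs′ : f m +ₘ χ s ≡ f m′ +ₘ χ s′
    fm+χs≡fm′+χs′ =
      trans (sym (χ-· m∈M (proj₁ good-s))) (trans (cong χ ms≡m′s′) (χ-· m′∈M (proj₁ good-s′)))
    m≡m′ : m ≡ m′
    m≡m′ = f-injective m m′ m∈M m′∈M (proj₁ (decompose-unique _ _ _ _
      (m , m∈M , refl) (proj₂ good-s) (m′ , m′∈M , refl) (proj₂ good-s′) fm+χs≡fm′+χs′))
    s≡s′ : s ≡ s′
    s≡s′ = *ₘ-cancelˡ p-prime (proj₁ (χ-extends-f m m∈M)) (begin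
      ([ p ] m) *ₘ s   ≡⟨ ·-as-*ₘ m s ⟨
      m ·[ p ] s       ≡⟨ ms≡m′s′ ⟩
      m′ ·[ p ] s′     ≡⟨ cong (λ z → z ·[ p ] s′) m≡m′ ⟨
      m ·[ p ] s′      ≡⟨ ·-as-*ₘ m s′ ⟩
      ([ p ] m) *ₘ s′  ∎)
      where open ≡-Reasoning

  S-avoids-0 : ∀ m s → m ∈ₗ M → s ∈ S → toℕ (m ·[ p ] s) ≢ 0
  S-avoids-0 m s m∈M s∈S ms≡0 =
    *ₘ-nonzero p-prime (proj₁ (χ-extends-f m m∈M)) (proj₁ (∈-decSubset⁻ _ s∈S))
      (trans (cong toℕ (sym (·-as-*ₘ m s))) ms≡0)

  character⇒splits : Splits M p
  character⇒splits = S , S-covers , S-unique , S-avoids-0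

theorem2p5 : (M : List ℤ) → Unique M → All (λ m → m ≢ 0ℤ) M →
    (k : ℕ) .{{_ : NonZero k}} → length M ∣ k →
    (f : ℤ → Fin k) → IsDirectKMLogarithm k M f →
    InfinitelyManyPrimes (Splits M)
theorem2p5 M _ _ k _ f (logarithm , km-primes) N
  with p , p-prime , N<p , character ← km-primes N
  = p , p-prime , N<p , character⇒splits {{_}} {{prime⇒nonZero p-prime}} p-prime logarithm character
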